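{- For even $b\ge2$: $K_{2\lambda}(1)=2\lambda$ for $0\le\lambda\le\frac{b-2}{2}$, and $K_{2\lambda+1}(1)=b+2\lambda$ for $0\le\lambda\le\frac{b-4}{2}$. For odd $b\ge3$: $K_{2\lambda}(1)=2\lambda$ for $0\le\lambda\le\frac{b-3}{2}$.
   Context: Fix a base $b\ge2$. For $v\in\mathbb{N}$, $s(v)$ is the sum of the base-$b$ digits of $v$, $f(v)=v+s(v)$, and $F(u)=|\{v\in\mathbb{N}: f(v)=u\}|$. For a residue class $i$ modulo $b-1$ (with $i$ even if $b$ is odd), $K_i(n)$ is the smallest $u\in\mathbb{N}$ with $F(u)=n$ and $u\equiv i\pmod{b-1}$. Subscripts are read modulo $b-1$. -}

module Defs where

open import Data.Nat using (ℕ; zero; suc; _+_; _*_; _∸_; _<_; _≟_)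
open import Data.Nat.DivMod using (_%_; _/_)
open import Data.List using (List; length; filter; upTo)
open import Data.Product using (_×_)
open import Relation.Binary.PropositionalEquality using (_≡_)
open import Relation.Nullary using (¬_)

-- digit sum in base b, with fuel (fuel ≥ v suffices for b ≥ 2)
digitSumFuel : ℕ → ℕ → ℕ → ℕ
digitSumFuel zero    b       v = 0
digitSumFuel (suc k) zero    v = 0        -- junk (b = 0 never used)
digitSumFuel (suc k) (suc c) zero = 0
digitSumFuel (suc k) (suc c) (suc w) =
  (suc w % suc c) + digitSumFuel k (suc c) (suc w / suc c)

s : ℕ → ℕ → ℕ
s b v = digitSumFuel v b v

f : ℕ → ℕ → ℕ
f b v = v + s b v

-- F(u) = #{ v ∈ ℕ : f(v) = u }.  Since f(v) ≥ v, every such v satisfies v ≤ u,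
-- so we count over v ∈ {0,…,u}.
F : ℕ → ℕ → ℕ
F b u = length (filter (λ v → f b v ≟ u) (upTo (suc u)))

_≡[mod_]_ : ℕ → ℕ → ℕ → Set
x ≡[mod zero ] y = x ≡ y
x ≡[mod suc k ] y = x % suc k ≡ y % suc k

KAdm : ℕ → ℕ → ℕ → ℕ → Set
KAdm b i n u = (F b u ≡ n) × (u ≡[mod (b ∸ 1) ] i)

IsK : ℕ → ℕ → ℕ → ℕ → Set
IsK b i n u = KAdm b i n u × (∀ u′ → u′ < u → ¬ KAdm b i n u′)

{-# OPTIONS --safe #-}
module Submission where

-- For v < b the digit sum is v itself, so f v = 2 v, while f (b + d) = b + 2 d + 1 for d < b.
-- Hence an even u < b has the single preimage u / 2 and an odd u < b has none.  If i < b − 1,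
-- then i is the least member of its residue class modulo b − 1, which gives K_i(1) = i for even i.
-- For odd i and even b, the class member i has no preimage, and the next one, i + (b − 1) = b + 2λ,
-- has the single preimage b / 2 + λ: the two-digit candidates b + d have odd images.

open import Defs
open import Data.Nat using (ℕ; zero; suc; _+_; _*_; _∸_; _/_; _%_; _≤_; _<_; _≟_; _<?_; s≤s; z≤n; z<s; NonZero)
open import Data.Nat.Properties
open import Data.Nat.DivMod using (m<n⇒m%n≡m; m<n⇒m/n≡0; [m+n]%n≡m%n; m/n≡1+[m∸n]/n; m≡m%n+[m/n]*n)
open import Data.Nat.Divisibility using (divides; m%n≡0⇒n∣m)
open import Data.Nat.Tactic.RingSolver using (solve-∀)
open import Data.List using ([]; length; filter; upTo; _++_; [_])
open import Data.List.Properties using (filter-++; length-++; upTo-∷ʳ; filter-accept; filter-reject; filter-none)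
open import Data.List.Relation.Unary.All as All using ()
open import Data.List.Membership.Propositional.Properties using (∈-upTo⁻)
open import Data.Product using (_×_; _,_)
open import Function using (_∘′_)
open import Level using (0ℓ)
open import Relation.Nullary using (¬_; yes; no; contradiction)
open import Relation.Unary using (Pred; Decidable)
open import Relation.Binary.PropositionalEquality
  using (_≡_; _≢_; refl; sym; trans; cong; cong₂; subst; subst₂; module ≡-Reasoning)

countBelow : {P : Pred ℕ 0ℓ} → Decidable P → ℕ → ℕ
countBelow P? n = length (filter P? (upTo n))

module _ {P : Pred ℕ 0ℓ} (P? : Decidable P) where

  private
    countBelow-suc : ∀ n → countBelow P? (suc n) ≡ countBelow P? n + length (filter P? [ n ])
    countBelow-suc n = begin
      length (filter P? (upTo (suc n)))               ≡⟨ cong (length ∘′ filter P?) (sym (upTo-∷ʳ n)) ⟩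
      length (filter P? (upTo n ++ [ n ]))             ≡⟨ cong length (filter-++ P? (upTo n) [ n ]) ⟩
      length (filter P? (upTo n) ++ filter P? [ n ])   ≡⟨ length-++ (filter P? (upTo n)) ⟩
      countBelow P? n + length (filter P? [ n ])      ∎
      where open ≡-Reasoning

  countBelow-accept : ∀ {n} → P n → countBelow P? (suc n) ≡ suc (countBelow P? n)
  countBelow-accept {n} Pn = begin
    countBelow P? (suc n)                        ≡⟨ countBelow-suc n ⟩
    countBelow P? n + length (filter P? [ n ])   ≡⟨ cong (λ xs → countBelow P? n + length xs) (filter-accept P? {xs = []} Pn) ⟩
    countBelow P? n + 1                          ≡⟨ +-comm (countBelow P? n) 1 ⟩
    suc (countBelow P? n)                        ∎
    where open ≡-Reasoning

  countBelow-reject : ∀ {n} → ¬ P n → countBelow P? (suc n) ≡ countBelow P? n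
  countBelow-reject {n} ¬Pn = begin
    countBelow P? (suc n)                        ≡⟨ countBelow-suc n ⟩
    countBelow P? n + length (filter P? [ n ])   ≡⟨ cong (λ xs → countBelow P? n + length xs) (filter-reject P? {xs = []} ¬Pn) ⟩
    countBelow P? n + 0                          ≡⟨ +-identityʳ (countBelow P? n) ⟩
    countBelow P? n                              ∎
    where open ≡-Reasoning

  countBelow≡0 : ∀ {n} → (∀ v → v < n → ¬ P v) → countBelow P? n ≡ 0
  countBelow≡0 none = cong length (filter-none P? (All.tabulate (λ v∈ → none _ (∈-upTo⁻ v∈))))

  countBelow≡1 : ∀ {n v₀} → v₀ < n → P v₀ → (∀ v → v < n → P v → v ≡ v₀) → countBelow P? n ≡ 1
  countBelow≡1 {suc n} {v₀} v₀<1+n Pv₀ unique with v₀ ≟ n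
  ... | yes refl = trans (countBelow-accept Pv₀)
                         (cong suc (countBelow≡0 (λ v v<n Pv → <-irrefl (unique v (m<n⇒m<1+n v<n) Pv) v<n)))
  ... | no v₀≢n  = trans (countBelow-reject (λ Pn → v₀≢n (sym (unique n ≤-refl Pn))))
                         (countBelow≡1 (≤∧≢⇒< (≤-pred v₀<1+n) v₀≢n) Pv₀ (λ v v<n → unique v (m<n⇒m<1+n v<n)))

F≡0 : ∀ {b u} → (∀ v → v ≤ u → f b v ≢ u) → F b u ≡ 0
F≡0 {b} {u} none = countBelow≡0 (λ v → f b v ≟ u) (λ v v<1+u → none v (≤-pred v<1+u))

F≡1 : ∀ {b u} v₀ → f b v₀ ≡ u → (∀ v → v ≤ u → f b v ≡ u → v ≡ v₀) → F b u ≡ 1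
F≡1 {b} {u} v₀ fv₀≡u unique =
  countBelow≡1 (λ v → f b v ≟ u) (s≤s (subst (v₀ ≤_) fv₀≡u (m≤m+n v₀ (s b v₀)))) fv₀≡u
    (λ v v<1+u → unique v (≤-pred v<1+u))

digitSumFuel-zero : ∀ k b → digitSumFuel k b 0 ≡ 0
digitSumFuel-zero zero    b       = refl
digitSumFuel-zero (suc k) zero    = refl
digitSumFuel-zero (suc k) (suc b) = refl

s-digit : ∀ {b v} → v < b → s b v ≡ v
s-digit {suc _} {zero}  _   = refl
s-digit {b@(suc _)} {v@(suc w)} v<b = begin
  v % b + digitSumFuel w b (v / b)   ≡⟨ cong₂ _+_ (m<n⇒m%n≡m v<b) (cong (digitSumFuel w b) (m<n⇒m/n≡0 v<b)) ⟩
  v + digitSumFuel w b 0             ≡⟨ cong (v +_) (digitSumFuel-zero w b) ⟩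
  v + 0                              ≡⟨ +-identityʳ v ⟩
  v                                  ∎
  where open ≡-Reasoning

s-twoDigit : ∀ {b d} → 2 ≤ b → d < b → s b (b + d) ≡ suc d
s-twoDigit {b@(suc (suc c))} {d} (s≤s (s≤s z≤n)) d<b = begin
  (b + d) % b + digitSumFuel (suc c + d) b ((b + d) / b) ≡⟨ cong₂ _+_ [b+d]%b≡d (cong (digitSumFuel (suc c + d) b) [b+d]/b≡1) ⟩
  d + suc (digitSumFuel (c + d) b 0)                      ≡⟨ cong (λ x → d + suc x) (digitSumFuel-zero (c + d) b) ⟩
  d + 1                                                  ≡⟨ +-comm d 1 ⟩
  suc d                                                  ∎
  where
  open ≡-Reasoning
  [b+d]%b≡d : (b + d) % b ≡ d
  [b+d]%b≡d = trans (cong (_% b) (+-comm b d)) (trans ([m+n]%n≡m%n d b) (m<n⇒m%n≡m d<b))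
  [b+d]/b≡1 : (b + d) / b ≡ 1
  [b+d]/b≡1 = begin
    (b + d) / b          ≡⟨ m/n≡1+[m∸n]/n (m≤m+n b d) ⟩
    1 + (b + d ∸ b) / b  ≡⟨ cong (λ x → 1 + x / b) (m+n∸m≡n b d) ⟩
    1 + d / b            ≡⟨ cong suc (m<n⇒m/n≡0 d<b) ⟩
    1                    ∎

f-digit : ∀ {b v} → v < b → f b v ≡ 2 * v
f-digit {v = v} v<b = cong (v +_) (trans (s-digit v<b) (sym (+-identityʳ v)))

f-twoDigit : ∀ {b d} → 2 ≤ b → d < b → f b (b + d) ≡ suc (b + 2 * d)
f-twoDigit {b} {d} 2≤b d<b = trans (cong (b + d +_) (s-twoDigit 2≤b d<b)) (b+d+[1+d]≡1+[b+2d] b d)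
  where
  b+d+[1+d]≡1+[b+2d] : ∀ b d → b + d + suc d ≡ suc (b + 2 * d)
  b+d+[1+d]≡1+[b+2d] = solve-∀

F-even-digit : ∀ {b} l → 2 * l < b → F b (2 * l) ≡ 1
F-even-digit l 2l<b = F≡1 l (f-digit (≤-<-trans (m≤m+n l (l + 0)) 2l<b))
  (λ v v≤2l fv≡2l → *-cancelˡ-≡ v l 2 (trans (sym (f-digit (≤-<-trans v≤2l 2l<b))) fv≡2l))

F-odd-digit : ∀ {b} l → 2 * l + 1 < b → F b (2 * l + 1) ≡ 0
F-odd-digit l i<b = F≡0 (λ v v≤i fv≡i →
  even≢odd v l (trans (sym (f-digit (≤-<-trans v≤i i<b))) (trans fv≡i (+-comm (2 * l) 1))))

≡%⇒≡-below : ∀ {m i u} .{{_ : NonZero m}} → i < m → u < i + m → u % m ≡ i % m → u ≡ i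
≡%⇒≡-below {m} {i} {u} i<m u<i+m u≡i = multiple≡0 (u / m) u≡i+[u/m]m
  where
  u≡i+[u/m]m : u ≡ i + (u / m) * m
  u≡i+[u/m]m = trans (m≡m%n+[m/n]*n u m) (cong (_+ (u / m) * m) (trans u≡i (m<n⇒m%n≡m i<m)))
  multiple≡0 : ∀ q → u ≡ i + q * m → u ≡ i
  multiple≡0 zero    u≡i+0 = trans u≡i+0 (+-identityʳ i)
  multiple≡0 (suc q) u≡i+m+qm =
    contradiction (≤-trans (+-monoʳ-≤ i (m≤m+n m (q * m))) (≤-reflexive (sym u≡i+m+qm))) (<⇒≱ u<i+m)

≡[mod]-refl : ∀ m {x} → x ≡[mod m ] x
≡[mod]-refl zero    = refl
≡[mod]-refl (suc m) = refl

isK-self : ∀ {b i n} → i < b ∸ 1 → KAdm b i n i → IsK b i n i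
isK-self {suc (suc c)} {i} i<1+c adm = adm , λ u′ u′<i (_ , u′≡i) →
  <-irrefl (≡%⇒≡-below i<1+c (≤-trans u′<i (m≤m+n i (suc c))) u′≡i) u′<i

isK-even : ∀ {b} l → 2 * l < b ∸ 1 → IsK b (2 * l) 1 (2 * l)
isK-even {b} l 2l<b-1 = isK-self 2l<b-1 (F-even-digit l (<-≤-trans 2l<b-1 (m∸n≤m b 1)) , ≡[mod]-refl (b ∸ 1))

F-even-twoDigit : ∀ {h l} → l < h → F (2 * h) (2 * h + 2 * l) ≡ 1
F-even-twoDigit {h} {l} l<h = F≡1 (h + l) (trans (f-digit v₀<b) (*-distribˡ-+ 2 h l)) unique
  where
  b = 2 * h
  u = b + 2 * l
  2l<b : 2 * l < b
  2l<b = *-monoʳ-< 2 l<h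
  v₀<b : h + l < b
  v₀<b = +-monoʳ-< h (subst (l <_) (sym (+-identityʳ h)) l<h)
  twoDigit-not-preimage : ∀ d → d < b → f b (b + d) ≢ u
  twoDigit-not-preimage d d<b fb+d≡u = even≢odd (h + l) (h + d) (begin
    2 * (h + l)        ≡⟨ *-distribˡ-+ 2 h l ⟩
    u                  ≡⟨ sym fb+d≡u ⟩
    f b (b + d)        ≡⟨ f-twoDigit (*-monoʳ-≤ 2 (≤-trans (s≤s z≤n) l<h)) d<b ⟩
    suc (b + 2 * d)    ≡⟨ cong suc (sym (*-distribˡ-+ 2 h d)) ⟩
    suc (2 * (h + d))  ∎)
    where open ≡-Reasoning
  unique : ∀ v → v ≤ u → f b v ≡ u → v ≡ h + l
  unique v v≤u fv≡u with v <? b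
  ... | yes v<b = *-cancelˡ-≡ v (h + l) 2 (trans (sym (f-digit v<b)) (trans fv≡u (sym (*-distribˡ-+ 2 h l))))
  ... | no  v≮b = contradiction (subst (λ w → f b w ≡ u) (sym b+d≡v) fv≡u) (twoDigit-not-preimage d d<b)
    where
    d = v ∸ b
    b+d≡v : b + d ≡ v
    b+d≡v = m+[n∸m]≡n (≮⇒≥ v≮b)
    d<b : d < b
    d<b = ≤-<-trans (+-cancelˡ-≤ b d (2 * l) (subst (_≤ u) (sym b+d≡v) v≤u)) 2l<b

isK-odd : ∀ {b} l → b % 2 ≡ 0 → 2 * l + 1 < b ∸ 1 → IsK b (2 * l + 1) 1 (b + 2 * l)
isK-odd {b@(suc (suc c))} l b%2≡0 i<1+c with m%n≡0⇒n∣m b 2 b%2≡0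
... | divides h b≡h*2 = (F-u≡1 , residue) , minimal
  where
  i = 2 * l + 1
  u = b + 2 * l
  b≡2h : b ≡ 2 * h
  b≡2h = trans b≡h*2 (*-comm h 2)
  u≡i+[b∸1] : u ≡ i + suc c
  u≡i+[b∸1] = rearrange c l
    where
    rearrange : ∀ c l → 2 + c + 2 * l ≡ 2 * l + 1 + suc c
    rearrange = solve-∀
  l<h : l < h
  l<h = *-cancelˡ-< 2 l h (subst (2 * l <_) b≡2h (<-trans (m<m+n (2 * l) z<s) (m<n⇒m<1+n i<1+c)))
  F-u≡1 : F b u ≡ 1
  F-u≡1 = subst (λ b′ → F b′ (b′ + 2 * l) ≡ 1) (sym b≡2h) (F-even-twoDigit l<h)
  residue : u % suc c ≡ i % suc c
  residue = trans (cong (_% suc c) u≡i+[b∸1]) ([m+n]%n≡m%n i (suc c))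
  minimal : ∀ u′ → u′ < u → ¬ KAdm b i 1 u′
  minimal u′ u′<u (Fu′≡1 , u′≡i) = 0≢1+n (begin
    0        ≡⟨ sym (F-odd-digit l (m<n⇒m<1+n i<1+c)) ⟩
    F b i    ≡⟨ cong (F b) (sym (≡%⇒≡-below i<1+c (subst (u′ <_) u≡i+[b∸1] u′<u) u′≡i)) ⟩
    F b u′   ≡⟨ Fu′≡1 ⟩
    1        ∎)
    where open ≡-Reasoning

m+2≤n⇒m<n∸1 : ∀ {m n} → m + 2 ≤ n → m < n ∸ 1
m+2≤n⇒m<n∸1 {m} {n} m+2≤n = m+n≤o⇒m≤o∸n (suc m) (subst (_≤ n) (+-suc m 1) m+2≤n)

theorem4p5 : (b : ℕ) → 2 ≤ b →
    ((b % 2 ≡ 0) →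
      ((λ′ : ℕ) → 2 * λ′ + 2 ≤ b → IsK b (2 * λ′) 1 (2 * λ′))
      × ((λ′ : ℕ) → 2 * λ′ + 4 ≤ b → IsK b (2 * λ′ + 1) 1 (b + 2 * λ′)))
    × ((b % 2 ≡ 1) →
      ((λ′ : ℕ) → 2 * λ′ + 3 ≤ b → IsK b (2 * λ′) 1 (2 * λ′)))
theorem4p5 b _ =
  (λ b-even → (λ l 2l+2≤b → isK-even l (m+2≤n⇒m<n∸1 2l+2≤b))
            , (λ l 2l+4≤b → isK-odd l b-even (m+2≤n⇒m<n∸1 (≤-trans (2l+1+2≤2l+4 l) 2l+4≤b))))
  , (λ _ l 2l+3≤b → isK-even l (m+2≤n⇒m<n∸1 (≤-trans (+-monoʳ-≤ (2 * l) (n≤1+n 2)) 2l+3≤b)))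
  where
  2l+1+2≤2l+4 : ∀ l → 2 * l + 1 + 2 ≤ 2 * l + 4
  2l+1+2≤2l+4 l = ≤-trans (≤-reflexive (+-assoc (2 * l) 1 2)) (+-monoʳ-≤ (2 * l) (n≤1+n 3))
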